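{- Let $n\ge 2$, let $v_1,\dots,v_n\in\mathbb{Z}^n$ be primitive vectors, and let $\mathbf{v}=[v_1,\dots,v_n]$ be the corresponding modular symbol, with $\|\mathbf{v}\|=|\det(v_1,\dots,v_n)|$. Let $A$ be the $n\times n$ matrix whose $i$-th column is $v_i$, and let $B=\{b_1,\dots,b_n\}$ be the set of rows of $A$ (viewed as vectors in $\mathbb{R}^n$). Let $E=\{e_1,\dots,e_n\}$ be the standard basis of $\mathbb{Z}^n$, fix $k\in\{1,\dots,n\}$ and put $w=e_k$. For $1\le i\le n$ let $\mathbf{v}_i$ be the modular symbol obtained from $\mathbf{v}$ by replacing $v_i$ with $w$, and let $B_i$ be the set of $n-1$ vectors obtained by orthogonally projecting the vectors of $B\smallsetminus\{b_k\}$ into $P_i$, the span of $E\smallsetminus\{e_i\}$. Then the following are equivalent: (1) $\|\mathbf{v}_i\|<\|\mathbf{v}\|$ for all $1\le i\le n$; (2) $\operatorname{vol} B_i<\operatorname{vol} B$ for all $1\le i\le n$. Here $\operatorname{vol} B$ is the volume of the parallelotope in $\mathbb{R}^n$ spanned by $B$, and $\operatorname{vol} B_i$ is the $(n-1)$-dimensional volume in $P_i$ of the parallelotope spanned by $B_i$, normalized so that fundamental domains of $\mathbb{Z}^n\subset\mathbb{R}^n$ and of $\mathbb{Z}^n\cap P_i\subset P_i$ each have volume $1$.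
   Context: A vector in $\mathbb{Z}^n$ is primitive if the gcd of its coordinates is $1$. A modular symbol is written $[v_1,\dots,v_n]$ with $v_i$ primitive vectors of $\mathbb{Z}^n$; its norm is $\|[v_1,\dots,v_n]\|=|\det(v_1,\dots,v_n)|$, the absolute value of the determinant of the matrix with columns $v_1,\dots,v_n$. -}

module Defs where

open import Data.Nat as ℕ using (ℕ; zero; suc)
open import Data.Nat.GCD using (gcd)
open import Data.Integer as ℤ using (ℤ; ∣_∣)
open import Data.Fin using (Fin; zero; suc; punchIn; _≟_)
open import Relation.Nullary using (yes; no)
open import Relation.Binary.PropositionalEquality using (_≡_)

Vecℤ : ℕ → Set
Vecℤ n = Fin n → ℤ

-- Square matrix: M r c = entry in row r, column c.
Matrix : ℕ → Set
Matrix n = Fin n → Fin n → ℤ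

gcdCoords : ∀ {n} → Vecℤ n → ℕ
gcdCoords {zero}  x = 0
gcdCoords {suc n} x = gcd ∣ x zero ∣ (gcdCoords (λ i → x (suc i)))

Primitive : ∀ {n} → Vecℤ n → Set
Primitive x = gcdCoords x ≡ 1

altSum : ∀ {n} → (Fin n → ℤ) → ℤ
altSum {zero}  f = ℤ.0ℤ
altSum {suc n} f = f zero ℤ.- altSum (λ j → f (suc j))

minor₀ : ∀ {n} → Matrix (suc n) → Fin (suc n) → Matrix n
minor₀ M j r c = M (suc r) (punchIn j c)

det : ∀ {n} → Matrix n → ℤ
det {zero}  M = ℤ.1ℤ
det {suc n} M = altSum (λ j → M zero j ℤ.* det (minor₀ M j))

-- A modular symbol [v_1,…,v_n]: the family of columns v i.
ModSym : ℕ → Set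
ModSym n = Fin n → Vecℤ n

colMatrix : ∀ {n} → ModSym n → Matrix n
colMatrix v r c = v c r

norm : ∀ {n} → ModSym n → ℕ
norm v = ∣ det (colMatrix v) ∣

e : ∀ {n} → Fin n → Vecℤ n
e k i with i ≟ k
... | yes _ = ℤ.1ℤ
... | no  _ = ℤ.0ℤ

replace : ∀ {n} → ModSym n → Fin n → Vecℤ n → ModSym n
replace v i w j with j ≟ i
... | yes _ = w
... | no  _ = v j

row : ∀ {n} → ModSym n → Fin n → Vecℤ n
row v r = colMatrix v r

-- Normalised volume of the parallelotope spanned by n vectors of ℤ^n
-- (fundamental domain of ℤ^n has volume 1): |det| of the matrix with these rows.
vol : ∀ {n} → (Fin n → Vecℤ n) → ℕ
vol b = ∣ det (λ r c → b r c) ∣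

-- orthogonal projection onto P_i = span(E ∖ {e_i}), in coordinates of
-- the basis E ∖ {e_i} of ℤ^{n+1} ∩ P_i (i.e. forget coordinate i).
proj : ∀ {n} → Fin (suc n) → Vecℤ (suc n) → Vecℤ n
proj i x c = x (punchIn i c)

Bproj : ∀ {n} → ModSym (suc n) → Fin (suc n) → Fin (suc n) → Fin n → Vecℤ n
Bproj v k i r = proj i (row v (punchIn k r))

-- Column i of the matrix of 𝐯_i is e_k, so Laplace expansion along that column gives
-- ‖𝐯_i‖ = |det A'|, where A' is A with row k and column i deleted. The rows of A' are the
-- rows b_r (r ≠ k) with coordinate i forgotten, i.e. the vectors of B_i, so ‖𝐯_i‖ = vol B_i;
-- and vol B = |det A| = ‖𝐯‖. Hence (1) and (2) are the same inequalities.
module Submission where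

open import Defs
open import Data.Nat using (ℕ; suc; _≤_; _<_)
open import Data.Fin using (Fin)
open import Function.Bundles using (_⇔_)

open import Data.Nat using (zero)
open import Data.Fin using (zero; suc; punchIn; punchOut; toℕ; _≟_)
open import Data.Fin.Properties using (punchIn-punchOut; punchInᵢ≢i; suc-injective)
open import Data.Integer using (ℤ; ∣_∣; _*_; _+_; _-_; -_; 0ℤ; 1ℤ; -1ℤ)
open import Data.Integer.Properties
  using (+-*-semiring; *-identityˡ; *-zeroʳ; *-assoc; +-identityˡ; +-identityʳ;
         -1*i≡-i; neg-distribˡ-*; ∣-i∣≡∣i∣)
open import Data.Integer.Tactic.RingSolver using (solve-∀)
open import Algebra.Properties.Semiring.Sum +-*-semiring
  using (sum; sum-remove; sum-cong-≗; sum-replicate-zero; *-distribˡ-sum)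
open import Data.Empty using (⊥-elim)
open import Function using (_∘_; _$_)
open import Function.Bundles using (mk⇔)
open import Relation.Nullary using (yes; no)
open import Relation.Binary.PropositionalEquality
  using (_≡_; _≢_; refl; sym; trans; cong; cong₂; subst; module ≡-Reasoning)
open ≡-Reasoning

infix 8 -1^_

-1^_ : ℕ → ℤ
-1^ zero  = 1ℤ
-1^ suc n = - -1^ n

∣-1^n*x∣≡∣x∣ : ∀ n x → ∣ -1^ n * x ∣ ≡ ∣ x ∣
∣-1^n*x∣≡∣x∣ zero    x = cong ∣_∣ (*-identityˡ x)
∣-1^n*x∣≡∣x∣ (suc n) x = begin
  ∣ - -1^ n * x ∣   ≡⟨ cong ∣_∣ (neg-distribˡ-* (-1^ n) x) ⟨
  ∣ - (-1^ n * x) ∣ ≡⟨ ∣-i∣≡∣i∣ (-1^ n * x) ⟩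
  ∣ -1^ n * x ∣     ≡⟨ ∣-1^n*x∣≡∣x∣ n x ⟩
  ∣ x ∣             ∎

-- punchOut j≢i is the position of column i once column j = punchIn i c is deleted.
-1^-punchIn-punchOut : ∀ {n} (i : Fin (suc n)) (c : Fin n) (j≢i : punchIn i c ≢ i) →
  -1^ toℕ (punchIn i c) * -1^ toℕ (punchOut j≢i) ≡ - (-1^ toℕ i * -1^ toℕ c)
-1^-punchIn-punchOut {suc n} zero    c       _   = ring (-1^ toℕ c)
  where ring : ∀ x → - x * 1ℤ ≡ - (1ℤ * x)
        ring = solve-∀
-1^-punchIn-punchOut         (suc i) zero    _   = ring (-1^ toℕ i)
  where ring : ∀ x → 1ℤ * x ≡ - (- x * 1ℤ)
        ring = solve-∀
-1^-punchIn-punchOut {suc n} (suc i) (suc c) j≢i = begin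
  (- s) * (- t)       ≡⟨ ring s t ⟩
  s * t               ≡⟨ -1^-punchIn-punchOut i c (j≢i ∘ cong suc) ⟩
  - (u * w)           ≡⟨ cong -_ (ring u w) ⟨
  - ((- u) * (- w))   ∎
  where
  s = -1^ toℕ (punchIn i c)
  t = -1^ toℕ (punchOut (j≢i ∘ cong suc))
  u = -1^ toℕ i
  w = -1^ toℕ c
  ring : ∀ x y → (- x) * (- y) ≡ x * y
  ring = solve-∀

punchIn-punchIn-swap : ∀ {n} (i : Fin (suc (suc n))) (c : Fin (suc n)) (c₂ : Fin n)
  (j≢i : punchIn i c ≢ i) →
  punchIn (punchIn i c) (punchIn (punchOut j≢i) c₂) ≡ punchIn i (punchIn c c₂)
punchIn-punchIn-swap         zero    c       c₂       _   = refl
punchIn-punchIn-swap         (suc i) zero    c₂       _   = refl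
punchIn-punchIn-swap         (suc i) (suc c) zero     _   = refl
punchIn-punchIn-swap {suc n} (suc i) (suc c) (suc c₂) j≢i =
  cong suc (punchIn-punchIn-swap i c c₂ (j≢i ∘ cong suc))

minor : ∀ {n} → Fin (suc n) → Fin (suc n) → Matrix (suc n) → Matrix n
minor k i N r c = N (punchIn k r) (punchIn i c)

minor-punchOut : ∀ {n} (N : Matrix (suc n)) {i j} (j≢i : j ≢ i) r →
  minor zero j N r (punchOut j≢i) ≡ N (suc r) i
minor-punchOut N j≢i r = cong (N (suc r)) (punchIn-punchOut j≢i)

altSum-cong : ∀ {n} {f g : Fin n → ℤ} → (∀ j → f j ≡ g j) → altSum f ≡ altSum g
altSum-cong {zero}  f≗g = refl
altSum-cong {suc n} f≗g = cong₂ _-_ (f≗g zero) (altSum-cong (f≗g ∘ suc))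

det-cong : ∀ {n} {M N : Matrix n} → (∀ r c → M r c ≡ N r c) → det M ≡ det N
det-cong {zero}  M≗N = refl
det-cong {suc n} M≗N =
  altSum-cong λ j → cong₂ _*_ (M≗N zero j) (det-cong λ r c → M≗N (suc r) (punchIn j c))

altSum≡sum : ∀ {n} (f : Fin n → ℤ) → altSum f ≡ sum (λ j → -1^ toℕ j * f j)
altSum≡sum {zero}  f = refl
altSum≡sum {suc n} f = cong₂ _+_ (sym (*-identityˡ (f zero))) (begin
  - altSum (f ∘ suc)                         ≡⟨ cong -_ (altSum≡sum (f ∘ suc)) ⟩
  - sum (λ j → -1^ toℕ j * f (suc j))        ≡⟨ -1*i≡-i _ ⟨
  -1ℤ * sum (λ j → -1^ toℕ j * f (suc j))    ≡⟨ *-distribˡ-sum -1ℤ (λ j → -1^ toℕ j * f (suc j)) ⟩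
  sum (λ j → -1ℤ * (-1^ toℕ j * f (suc j)))  ≡⟨ sum-cong-≗ (λ j → ring (-1^ toℕ j) (f (suc j))) ⟩
  sum (λ j → - -1^ toℕ j * f (suc j))        ∎)
  where
  ring : ∀ s x → -1ℤ * (s * x) ≡ - s * x
  ring = solve-∀

sum-zero : ∀ {n} {f : Fin n → ℤ} → (∀ j → f j ≡ 0ℤ) → sum f ≡ 0ℤ
sum-zero {n} f≗0 = trans (sum-cong-≗ f≗0) (sum-replicate-zero n)

cofactorTerm : ∀ {n} → Matrix (suc n) → Fin (suc n) → ℤ
cofactorTerm N j = -1^ toℕ j * (N zero j * det (minor zero j N))

cofactorTerm-zeroEntry : ∀ {n} (N : Matrix (suc n)) j → N zero j ≡ 0ℤ → cofactorTerm N j ≡ 0ℤ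
cofactorTerm-zeroEntry N j N₀ⱼ≡0 rewrite N₀ⱼ≡0 = *-zeroʳ (-1^ toℕ j)

cofactorTerm-singularMinor : ∀ {n} (N : Matrix (suc n)) j →
  det (minor zero j N) ≡ 0ℤ → cofactorTerm N j ≡ 0ℤ
cofactorTerm-singularMinor N j detM≡0 rewrite detM≡0 | *-zeroʳ (N zero j) = *-zeroʳ (-1^ toℕ j)

det≡sum-cofactorTerm : ∀ {n} (N : Matrix (suc n)) → det N ≡ sum (cofactorTerm N)
det≡sum-cofactorTerm N = altSum≡sum (λ j → N zero j * det (minor zero j N))

det-expandAt : ∀ {n} (N : Matrix (suc n)) i →
  det N ≡ cofactorTerm N i + sum (cofactorTerm N ∘ punchIn i)
det-expandAt N i = trans (det≡sum-cofactorTerm N) (sum-remove {i = i} (cofactorTerm N))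

det-zeroColumn : ∀ {n} (N : Matrix n) i → (∀ r → N r i ≡ 0ℤ) → det N ≡ 0ℤ
det-zeroColumn {suc n} N i N·ᵢ≡0 = begin
  det N                                                ≡⟨ det-expandAt N i ⟩
  cofactorTerm N i + sum (cofactorTerm N ∘ punchIn i)  ≡⟨ cong₂ _+_ pivot (sum-zero offPivot) ⟩
  0ℤ                                                   ∎
  where
  pivot : cofactorTerm N i ≡ 0ℤ
  pivot = cofactorTerm-zeroEntry N i (N·ᵢ≡0 zero)
  offPivot : ∀ c → cofactorTerm N (punchIn i c) ≡ 0ℤ
  offPivot c = cofactorTerm-singularMinor N (punchIn i c)
    (det-zeroColumn (minor zero (punchIn i c) N) (punchOut j≢i)
      λ r → trans (minor-punchOut N j≢i r) (N·ᵢ≡0 (suc r)))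
    where j≢i = punchInᵢ≢i i c

det-unitColumn : ∀ {n} (N : Matrix (suc n)) k i → N k i ≡ 1ℤ → (∀ r → r ≢ k → N r i ≡ 0ℤ) →
  det N ≡ -1^ toℕ k * -1^ toℕ i * det (minor k i N)
det-unitColumn N zero i Nₖᵢ≡1 N·ᵢ≡0 = begin
  det N                                                ≡⟨ det-expandAt N i ⟩
  cofactorTerm N i + sum (cofactorTerm N ∘ punchIn i)  ≡⟨ cong₂ _+_ pivot (sum-zero offPivot) ⟩
  1ℤ * -1^ toℕ i * det (minor zero i N) + 0ℤ           ≡⟨ +-identityʳ _ ⟩
  1ℤ * -1^ toℕ i * det (minor zero i N)                ∎
  where
  ring : ∀ s d → s * (1ℤ * d) ≡ 1ℤ * s * d
  ring = solve-∀
  pivot : cofactorTerm N i ≡ 1ℤ * -1^ toℕ i * det (minor zero i N)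
  pivot rewrite Nₖᵢ≡1 = ring (-1^ toℕ i) (det (minor zero i N))
  offPivot : ∀ c → cofactorTerm N (punchIn i c) ≡ 0ℤ
  offPivot c = cofactorTerm-singularMinor N (punchIn i c)
    (det-zeroColumn (minor zero (punchIn i c) N) (punchOut j≢i)
      λ r → trans (minor-punchOut N j≢i r) (N·ᵢ≡0 (suc r) λ ()))
    where j≢i = punchInᵢ≢i i c
det-unitColumn {suc n} N (suc k) i Nₖᵢ≡1 N·ᵢ≡0 = begin
  det N                                                ≡⟨ det-expandAt N i ⟩
  cofactorTerm N i + sum (cofactorTerm N ∘ punchIn i)  ≡⟨ cong₂ _+_ pivot (sum-cong-≗ offPivot) ⟩
  0ℤ + sum (λ c → σ * cofactorTerm C c)                ≡⟨ +-identityˡ _ ⟩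
  sum (λ c → σ * cofactorTerm C c)                     ≡⟨ *-distribˡ-sum σ (cofactorTerm C) ⟨
  σ * sum (cofactorTerm C)                             ≡⟨ cong (σ *_) (det≡sum-cofactorTerm C) ⟨
  σ * det C                                            ∎
  where
  σ = -1^ toℕ (suc k) * -1^ toℕ i
  C = minor (suc k) i N
  pivot : cofactorTerm N i ≡ 0ℤ
  pivot = cofactorTerm-zeroEntry N i (N·ᵢ≡0 zero λ ())
  collect-signs : ∀ s t u x d → s * (x * (u * t * d)) ≡ (s * t) * (u * x * d)
  collect-signs = solve-∀
  distribute-signs : ∀ s t u x d → - (s * t) * (u * x * d) ≡ (- u * s) * (t * (x * d))
  distribute-signs = solve-∀
  offPivot : ∀ c → cofactorTerm N (punchIn i c) ≡ σ * cofactorTerm C c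
  offPivot c = begin
    -1^ toℕ j * (N zero j * det (minor zero j N))
      ≡⟨ cong (λ d → -1^ toℕ j * (N zero j * d))
           (det-unitColumn (minor zero j N) k (punchOut j≢i) (trans (minor-punchOut N j≢i k) Nₖᵢ≡1)
           λ r r≢k → trans (minor-punchOut N j≢i r) (N·ᵢ≡0 (suc r) (r≢k ∘ suc-injective))) ⟩
    -1^ toℕ j * (N zero j * (-1^ toℕ k * -1^ toℕ (punchOut j≢i) * det D))
      ≡⟨ collect-signs (-1^ toℕ j) (-1^ toℕ (punchOut j≢i)) (-1^ toℕ k) (N zero j) (det D) ⟩
    (-1^ toℕ j * -1^ toℕ (punchOut j≢i)) * (-1^ toℕ k * N zero j * det D)
      ≡⟨ cong (_* (-1^ toℕ k * N zero j * det D)) (-1^-punchIn-punchOut i c j≢i) ⟩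
    - (-1^ toℕ i * -1^ toℕ c) * (-1^ toℕ k * N zero j * det D)
      ≡⟨ distribute-signs (-1^ toℕ i) (-1^ toℕ c) (-1^ toℕ k) (N zero j) (det D) ⟩
    σ * (-1^ toℕ c * (N zero j * det D))
      ≡⟨ cong (λ d → σ * (-1^ toℕ c * (N zero j * d)))
           (det-cong λ r c₂ → cong (N (suc (punchIn k r))) (punchIn-punchIn-swap i c c₂ j≢i)) ⟩
    σ * cofactorTerm C c
      ∎
    where
    j = punchIn i c
    j≢i = punchInᵢ≢i i c
    D = minor k (punchOut j≢i) (minor zero j N)

∣det∣-unitColumn : ∀ {n} (N : Matrix (suc n)) k i → N k i ≡ 1ℤ → (∀ r → r ≢ k → N r i ≡ 0ℤ) →
  ∣ det N ∣ ≡ ∣ det (minor k i N) ∣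
∣det∣-unitColumn N k i Nₖᵢ≡1 N·ᵢ≡0 = begin
  ∣ det N ∣                             ≡⟨ cong ∣_∣ (det-unitColumn N k i Nₖᵢ≡1 N·ᵢ≡0) ⟩
  ∣ -1^ toℕ k * -1^ toℕ i * det M ∣     ≡⟨ cong ∣_∣ (*-assoc (-1^ toℕ k) (-1^ toℕ i) (det M)) ⟩
  ∣ -1^ toℕ k * (-1^ toℕ i * det M) ∣   ≡⟨ ∣-1^n*x∣≡∣x∣ (toℕ k) _ ⟩
  ∣ -1^ toℕ i * det M ∣                 ≡⟨ ∣-1^n*x∣≡∣x∣ (toℕ i) _ ⟩
  ∣ det M ∣                             ∎
  where M = minor k i N

e-diagonal : ∀ {n} (k : Fin n) → e k k ≡ 1ℤ
e-diagonal k with k ≟ k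
... | yes _  = refl
... | no k≢k = ⊥-elim (k≢k refl)

e-offDiagonal : ∀ {n} (k r : Fin n) → r ≢ k → e k r ≡ 0ℤ
e-offDiagonal k r r≢k with r ≟ k
... | yes r≡k = ⊥-elim (r≢k r≡k)
... | no _    = refl

replace-at : ∀ {n} (v : ModSym n) i w → replace v i w i ≡ w
replace-at v i w with i ≟ i
... | yes _  = refl
... | no i≢i = ⊥-elim (i≢i refl)

replace-elsewhere : ∀ {n} (v : ModSym n) i w j → j ≢ i → replace v i w j ≡ v j
replace-elsewhere v i w j j≢i with j ≟ i
... | yes j≡i = ⊥-elim (j≢i j≡i)
... | no _    = refl

norm-replace-e≡vol-Bproj : ∀ {n} (v : ModSym (suc n)) k i →
  norm (replace v i (e k)) ≡ vol (Bproj v k i)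
norm-replace-e≡vol-Bproj v k i = begin
  ∣ det A ∣              ≡⟨ ∣det∣-unitColumn A k i (column k (e-diagonal k))
                              (λ r r≢k → column r (e-offDiagonal k r r≢k)) ⟩
  ∣ det (minor k i A) ∣  ≡⟨ cong ∣_∣ (det-cong λ r c → cong (_$ punchIn k r)
                              (replace-elsewhere v i (e k) (punchIn i c) (punchInᵢ≢i i c))) ⟩
  vol (Bproj v k i)      ∎
  where
  A = colMatrix (replace v i (e k))
  column : ∀ r {x} → e k r ≡ x → A r i ≡ x
  column r = trans (cong (_$ r) (replace-at v i (e k)))

lemma3p8 : (m : ℕ) → 1 ≤ m → (v : ModSym (suc m)) → (∀ i → Primitive (v i)) →
    (k : Fin (suc m)) →
    ((∀ i → norm (replace v i (e k)) < norm v)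
      ⇔ (∀ i → vol (Bproj v k i) < vol (row v)))
lemma3p8 m _ v _ k = mk⇔
  (λ ‖vᵢ‖<‖v‖ i → subst (_< norm v) (norm-replace-e≡vol-Bproj v k i) (‖vᵢ‖<‖v‖ i))
  (λ volBᵢ<volB i → subst (_< norm v) (sym (norm-replace-e≡vol-Bproj v k i)) (volBᵢ<volB i))
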